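{- There are $\mathrm{FO}^2(V_{\textit{ancOf}})$ sentences $\varphi_n$ of size $O(n)$ that are satisfiable over binary trees satisfying the unary alphabet restriction, such that the minimum depth of a binary tree satisfying the unary alphabet restriction and $\varphi_n$ grows as $2^n$.
   Context: Trees are finite ordered labelled trees; binary trees are trees in which each node has at most two children. A tree satisfies the unary alphabet restriction (UAR) if exactly one unary predicate holds at each node. $V_{\textit{ancOf}}$ consists of the unary predicates, equality, and the ancestor relation $\mathrm{AncOf}$. $\mathrm{FO}^2(V)$ is first-order logic over $V$ with at most two variables in every subformula. -}

module Defs where

open import Data.Nat using (ℕ; zero; suc; _+_; _≤_; _⊔_)
open import Data.Bool using (Bool; true; false)
open import Data.Fin using (Fin)
open import Data.List using (List; []; _∷_; length; lookup)
open import Data.Product using (Σ; _×_)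
open import Data.Sum using (_⊎_)
open import Data.Empty using (⊥)
open import Relation.Nullary using (¬_)
open import Relation.Binary.PropositionalEquality using (_≡_)

-- Finite ordered labelled trees.
-- A label is the set of unary predicates (indexed by ℕ) holding at the node.

data Tree : Set where
  node : (ℕ → Bool) → List Tree → Tree

label : Tree → ℕ → Bool
label (node l _) = l

children : Tree → List Tree
children (node _ ts) = ts

data Pos : Tree → Set where
  root  : ∀ {l ts} → Pos (node l ts)
  child : ∀ {l ts} (i : Fin (length ts)) → Pos (lookup ts i) → Pos (node l ts)

labelAt : ∀ {t} → Pos t → ℕ → Bool
labelAt {t} root = label t
labelAt (child i p) = labelAt p

data AncOf : ∀ {t} → Pos t → Pos t → Set where
  root-anc : ∀ {l ts} (i : Fin (length ts)) (p : Pos (lookup ts i)) →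
             AncOf {node l ts} root (child i p)
  step     : ∀ {l ts} (i : Fin (length ts)) {p q : Pos (lookup ts i)} →
             AncOf p q → AncOf {node l ts} (child i p) (child i q)

data Binary : Tree → Set where
  bin : ∀ {l ts} → length ts ≤ 2 → (∀ i → Binary (lookup ts i)) → Binary (node l ts)

UAR : Tree → Set
UAR t = ∀ (p : Pos t) → Σ ℕ λ k → labelAt p k ≡ true × (∀ j → labelAt p j ≡ true → j ≡ k)

mutual
  depth : Tree → ℕ
  depth (node _ []) = 0
  depth (node _ (t ∷ ts)) = suc (maxDepth (t ∷ ts))

  maxDepth : List Tree → ℕ
  maxDepth [] = 0
  maxDepth (t ∷ ts) = depth t ⊔ maxDepth ts

data Var : Set where
  vx vy : Var

data Form : Set where
  pred : ℕ → Var → Form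
  eq   : Var → Var → Form
  anc  : Var → Var → Form
  neg  : Form → Form
  and  : Form → Form → Form
  or   : Form → Form → Form
  ex   : Var → Form → Form

size : Form → ℕ
size (pred _ _) = 1
size (eq _ _) = 1
size (anc _ _) = 1
size (neg φ) = suc (size φ)
size (and φ ψ) = suc (size φ + size ψ)
size (or φ ψ) = suc (size φ + size ψ)
size (ex _ φ) = suc (size φ)

data FreeIn (v : Var) : Form → Set where
  fpred : ∀ {k} → FreeIn v (pred k v)
  feqˡ  : ∀ {w} → FreeIn v (eq v w)
  feqʳ  : ∀ {w} → FreeIn v (eq w v)
  fancˡ : ∀ {w} → FreeIn v (anc v w)
  fancʳ : ∀ {w} → FreeIn v (anc w v)
  fneg  : ∀ {φ} → FreeIn v φ → FreeIn v (neg φ)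
  fandˡ : ∀ {φ ψ} → FreeIn v φ → FreeIn v (and φ ψ)
  fandʳ : ∀ {φ ψ} → FreeIn v ψ → FreeIn v (and φ ψ)
  forˡ  : ∀ {φ ψ} → FreeIn v φ → FreeIn v (or φ ψ)
  forʳ  : ∀ {φ ψ} → FreeIn v ψ → FreeIn v (or φ ψ)
  fex   : ∀ {w φ} → ¬ (v ≡ w) → FreeIn v φ → FreeIn v (ex w φ)

Sentence : Form → Set
Sentence φ = ∀ v → ¬ FreeIn v φ

Assign : Tree → Set
Assign t = Var → Pos t

update : ∀ {t} → Assign t → Var → Pos t → Assign t
update ρ vx a vx = a
update ρ vx a vy = ρ vy
update ρ vy a vx = ρ vx
update ρ vy a vy = a

Sat : (t : Tree) → Form → Assign t → Set
Sat t (pred k v) ρ = labelAt (ρ v) k ≡ true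
Sat t (eq v w) ρ = ρ v ≡ ρ w
Sat t (anc v w) ρ = AncOf (ρ v) (ρ w)
Sat t (neg φ) ρ = ¬ Sat t φ ρ
Sat t (and φ ψ) ρ = Sat t φ ρ × Sat t ψ ρ
Sat t (or φ ψ) ρ = Sat t φ ρ ⊎ Sat t ψ ρ
Sat t (ex v φ) ρ = Σ (Pos t) λ a → Sat t φ (update ρ v a)

-- t ⊨ φ for a sentence φ (the assignment is irrelevant; use the root)
rootPos : (t : Tree) → Pos t
rootPos (node _ _) = root

Models : Tree → Form → Set
Models t φ = Sat t φ (λ _ → rootPos t)

BinUAR : Tree → Set
BinUAR t = Binary t × UAR t

module Submission where

-- φₙ describes an n-bit binary counter. Spine nodes (label 0) must form a single path;
-- every counter node (label 1) stores n bits and n + 1 carries as the set of labels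
-- occurring on its proper ancestors. φₙ asks for a counter with value 0, for a successor
-- of every counter of value < 2ⁿ − 1 (bitwise: new bit = bit xor carry, next carry =
-- bit ∧ carry), and for all counters below a non-spine node to agree. Hence all 2ⁿ values
-- are stored somewhere, whereas in a binary tree the counters hanging off the spine path
-- can store at most 2 (depth + 1) values: the depth is Ω(2ⁿ). Conversely, a spine of
-- length 2ⁿ carrying, for every value, a path of at most 2n + 1 labels down to a counter
-- is a model of depth O(2ⁿ). Each conjunct talks about one bit, so |φₙ| = O(n).

open import Defs
open import Data.Bool using (Bool; true; false; not; _∧_; _∨_; _xor_; T)
open import Data.Bool.Properties using (T-∨; T-∧; T-≡)
import Data.Bool.Properties as Bool
open import Data.Empty using (⊥; ⊥-elim)
open import Data.Fin using (Fin; toℕ) renaming (zero to fzero; suc to fsuc)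
open import Data.Fin.Properties using (toℕ<n)
open import Data.List using (List; []; _∷_; _++_; length; lookup)
import Data.List as List
open import Data.List.Membership.Propositional using (_∈_)
open import Data.List.Membership.Propositional.Properties
  using (∈-++⁺ˡ; ∈-++⁺ʳ; ∈-map⁺; ∈-filter⁺; ∈-filter⁻; ∈-upTo⁺)
open import Data.List.Properties using (length-++; length-map; length-filter; length-upTo)
open import Data.List.Relation.Unary.Any using (here; there)
open import Data.Nat using (ℕ; zero; suc; _+_; _*_; _^_; _≤_; _<_; _≡ᵇ_; _≤?_; z≤n; s≤s)
open import Data.Nat.Properties
open import Data.Nat.Tactic.RingSolver using (solve)
open import Data.Product using (Σ; _×_; _,_; proj₂)
open import Data.Sum using (_⊎_; inj₁; inj₂)
open import Data.Vec using (Vec; []; _∷_; tabulate; replicate)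
import Data.Vec as Vec
open import Data.Vec.Properties using (≡-dec; lookup-replicate; lookup∘tabulate; tabulate∘lookup; tabulate-cong)
open import Effect.Monad using (RawMonad)
open import Function using (_∘_; case_of_; _⇔_; mk⇔; Equivalence)
open import Function.Properties.Equivalence using () renaming (trans to ⇔-trans)
open import Level using (0ℓ)
open import Relation.Binary.PropositionalEquality
open import Relation.Nullary using (¬_; Dec; yes; no; does; contradiction; ¬¬-map)
open import Relation.Nullary.Decidable
  using (T?; map′; _⊎-dec_; _×-dec_; ¬?; does-⇔; dec-true; dec-false; decidable-stable; ¬¬-excluded-middle)
open import Relation.Nullary.Negation using (¬¬-Monad)

open Equivalence using (to; from)

⊤F : Form
⊤F = ex vx (eq vx vx)

∀F : Var → Form → Form
∀F v φ = neg (ex v (neg φ))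

_⇒F_ _⇔F_ : Form → Form → Form
φ ⇒F ψ = neg (and φ (neg ψ))
φ ⇔F ψ = and (φ ⇒F ψ) (ψ ⇒F φ)

⋀ : (n : ℕ) → (Fin n → Form) → Form
⋀ zero    φ = ⊤F
⋀ (suc n) φ = and (φ fzero) (⋀ n (φ ∘ fsuc))

other : Var → Var
other vx = vy
other vy = vx

aboveF : Var → ℕ → Form
aboveF v L = ex (other v) (and (anc (other v) v) (pred L (other v)))

⊴F : Var → Var → Form
⊴F v w = or (eq v w) (anc v w)

-- Above a counter, label carryL i stands for "carry into bit i" and bitL i for "bit i is set".
spineL counterL : ℕ
spineL   = 0
counterL = 1

carryL bitL : ℕ → ℕ
carryL i = 2 + i * 2
bitL   i = 3 + i * 2

spineIsChain carryIntoFirst : Form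
spineIsChain = ∀F vx (∀F vy (and (pred spineL vx) (pred spineL vy)
                         ⇒F or (eq vx vy) (or (anc vx vy) (anc vy vx))))
carryIntoFirst = ∀F vx (pred counterL vx ⇒F aboveF vx (carryL 0))

carryEquation incrementBit : ℕ → Form
carryEquation i = aboveF vx (carryL (suc i)) ⇔F and (aboveF vx (bitL i)) (aboveF vx (carryL i))
incrementBit  i = aboveF vy (bitL i) ⇔F (aboveF vx (bitL i) ⇔F neg (aboveF vx (carryL i)))

carryRule bitsUniform : ℕ → Form
carryRule i = ∀F vx (pred counterL vx ⇒F carryEquation i)
bitsUniform i = ∀F vx (neg (pred spineL vx) ⇒F
  neg (and (ex vy (and (⊴F vx vy) (and (pred counterL vy) (aboveF vy (bitL i)))))
           (ex vy (and (⊴F vx vy) (and (pred counterL vy) (neg (aboveF vy (bitL i))))))))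

zeroCounter successorCounter counterφ : ℕ → Form
zeroCounter n = ex vx (and (pred counterL vx) (⋀ n λ i → neg (aboveF vx (bitL (toℕ i)))))
successorCounter n = ∀F vx (and (pred counterL vx) (neg (aboveF vx (carryL n))) ⇒F
  ex vy (and (pred counterL vy) (⋀ n (incrementBit ∘ toℕ))))
counterφ n = and spineIsChain (and carryIntoFirst (and (zeroCounter n) (and (successorCounter n)
  (and (⋀ n (carryRule ∘ toℕ)) (⋀ n (bitsUniform ∘ toℕ))))))

_==V_ : Var → Var → Bool
vx ==V vx = true
vy ==V vy = true
vx ==V vy = false
vy ==V vx = false

occursFree : Var → Form → Bool
occursFree v (pred _ w) = v ==V w
occursFree v (eq w w′)  = (v ==V w) ∨ (v ==V w′)
occursFree v (anc w w′) = (v ==V w) ∨ (v ==V w′)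
occursFree v (neg φ)    = occursFree v φ
occursFree v (and φ ψ)  = occursFree v φ ∨ occursFree v ψ
occursFree v (or φ ψ)   = occursFree v φ ∨ occursFree v ψ
occursFree v (ex w φ)   = not (v ==V w) ∧ occursFree v φ

==V-refl : ∀ v → T (v ==V v)
==V-refl vx = _
==V-refl vy = _

==V-≢ : ∀ {v w} → ¬ v ≡ w → T (not (v ==V w))
==V-≢ {vx} {vx} v≢w = v≢w refl
==V-≢ {vy} {vy} v≢w = v≢w refl
==V-≢ {vx} {vy} _   = _
==V-≢ {vy} {vx} _   = _

FreeIn⇒occursFree : ∀ {v φ} → FreeIn v φ → T (occursFree v φ)
FreeIn⇒occursFree {v} fpred = ==V-refl v
FreeIn⇒occursFree {v} feqˡ  = T-∨ .from (inj₁ (==V-refl v))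
FreeIn⇒occursFree {v} feqʳ  = T-∨ .from (inj₂ (==V-refl v))
FreeIn⇒occursFree {v} fancˡ = T-∨ .from (inj₁ (==V-refl v))
FreeIn⇒occursFree {v} fancʳ = T-∨ .from (inj₂ (==V-refl v))
FreeIn⇒occursFree (fneg f)  = FreeIn⇒occursFree f
FreeIn⇒occursFree (fandˡ f) = T-∨ .from (inj₁ (FreeIn⇒occursFree f))
FreeIn⇒occursFree (fandʳ f) = T-∨ .from (inj₂ (FreeIn⇒occursFree f))
FreeIn⇒occursFree (forˡ f)  = T-∨ .from (inj₁ (FreeIn⇒occursFree f))
FreeIn⇒occursFree (forʳ f)  = T-∨ .from (inj₂ (FreeIn⇒occursFree f))
FreeIn⇒occursFree (fex v≢w f) = T-∧ .from (==V-≢ v≢w , FreeIn⇒occursFree f)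

occursFree-⋀ : ∀ v n (φ : Fin n → Form) → (∀ i → occursFree v (φ i) ≡ false) → occursFree v (⋀ n φ) ≡ false
occursFree-⋀ vx zero    φ _ = refl
occursFree-⋀ vy zero    φ _ = refl
occursFree-⋀ v  (suc n) φ closed rewrite closed fzero = occursFree-⋀ v n (φ ∘ fsuc) (closed ∘ fsuc)

counterφ-sentence : ∀ n → Sentence (counterφ n)
counterφ-sentence n v free = subst T (closed v) (FreeIn⇒occursFree free)
  where
  closed : ∀ v → occursFree v (counterφ n) ≡ false
  closed vx rewrite occursFree-⋀ vx n (carryRule ∘ toℕ) (λ _ → refl) =
    occursFree-⋀ vx n (bitsUniform ∘ toℕ) (λ _ → refl)
  closed vy rewrite occursFree-⋀ vy n (λ i → neg (aboveF vx (bitL (toℕ i)))) (λ _ → refl)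
                  | occursFree-⋀ vy n (carryRule ∘ toℕ) (λ _ → refl) =
    occursFree-⋀ vy n (bitsUniform ∘ toℕ) (λ _ → refl)

size-⋀ : ∀ n (φ : Fin n → Form) {s} → (∀ i → size (φ i) ≡ s) → size (⋀ n φ) ≡ n * suc s + 2
size-⋀ zero    φ _ = refl
size-⋀ (suc n) φ {s} size≡ rewrite size≡ fzero | size-⋀ n (φ ∘ fsuc) (size≡ ∘ fsuc) =
  cong suc (sym (+-assoc s (n * suc s) 2))

size-counterφ : ∀ n → size (counterφ n) ≡ 60 + 147 * n
size-counterφ n
  rewrite size-⋀ n (λ i → neg (aboveF vx (bitL (toℕ i)))) (λ _ → refl)
        | size-⋀ n (incrementBit ∘ toℕ) (λ _ → refl)
        | size-⋀ n (carryRule ∘ toℕ) (λ _ → refl)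
        | size-⋀ n (bitsUniform ∘ toℕ) (λ _ → refl)
        = solve (n List.∷ List.[])

size-counterφ-linear : ∀ {n} → 1 ≤ n → size (counterφ n) ≤ 207 * n
size-counterφ-linear {suc k} _ = begin
  size (counterφ (suc k))    ≡⟨ size-counterφ (suc k) ⟩
  60 + 147 * suc k           ≤⟨ m≤m+n _ (60 * k) ⟩
  60 + 147 * suc k + 60 * k  ≡⟨ solve (k List.∷ List.[]) ⟩
  207 * suc k                ∎
  where open ≤-Reasoning

Spine Counter : ∀ {t} → Pos t → Set
Spine   p = labelAt p spineL ≡ true
Counter p = labelAt p counterL ≡ true

_⊴_ : ∀ {t} → Pos t → Pos t → Set
p ⊴ q = p ≡ q ⊎ AncOf p q

Above : ∀ {t} → Pos t → ℕ → Set
Above {t} p L = Σ (Pos t) λ a → AncOf a p × labelAt a L ≡ true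

Above-child : ∀ {l ts i} {p : Pos (lookup ts i)} {L} → Above {node l ts} (child i p) L ⇔ (l L ≡ true ⊎ Above p L)
Above-child {i = i} {p} = mk⇔
  (λ { (root , root-anc _ _ , lab) → inj₁ lab ; (child _ a , step _ a<p , lab) → inj₂ (a , a<p , lab) })
  (λ { (inj₁ lab) → root , root-anc i p , lab ; (inj₂ (a , a<p , lab)) → child i a , step i a<p , lab })

Above-child-unlabelled : ∀ {l ts i} {p : Pos (lookup ts i)} {L} → l L ≡ false → Above {node l ts} (child i p) L ⇔ Above p L
Above-child-unlabelled ¬lab = mk⇔
  (λ above → case Above-child .to above of λ
     { (inj₁ lab)    → contradiction (trans (sym ¬lab) lab) λ ()
     ; (inj₂ above′) → above′ })
  (Above-child .from ∘ inj₂)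

above? : ∀ {t} (p : Pos t) L → Dec (Above p L)
above? root L = no λ { (_ , () , _) }
above? {node l ts} (child i p) L = map′ (Above-child .from) (Above-child .to) ((l L Bool.≟ true) ⊎-dec above? p L)

facts : ∀ {t} → Pos t → ℕ → Bool
facts p k = does (above? p (2 + k))

-- Sat interprets _⇔F_ as this classical biconditional.
_⇔ᶜ_ : Set → Set → Set
A ⇔ᶜ B = ¬ (A × ¬ B) × ¬ (B × ¬ A)

⇔ᶜ⇔does≡ : ∀ {A B : Set} (a? : Dec A) (b? : Dec B) → (A ⇔ᶜ B) ⇔ (does a? ≡ does b?)
⇔ᶜ⇔does≡ a? b? = mk⇔ (to′ a? b?) (from′ a? b?)
  where
  to′ : ∀ {A B : Set} (a? : Dec A) (b? : Dec B) → A ⇔ᶜ B → does a? ≡ does b?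
  to′ (yes a) (yes b) _         = refl
  to′ (yes a) (no ¬b) (a⇒b , _) = contradiction (a , ¬b) a⇒b
  to′ (no ¬a) (yes b) (_ , b⇒a) = contradiction (b , ¬a) b⇒a
  to′ (no ¬a) (no ¬b) _         = refl
  from′ : ∀ {A B : Set} (a? : Dec A) (b? : Dec B) → does a? ≡ does b? → A ⇔ᶜ B
  from′ (yes a) (yes b) _ = (λ (_ , ¬b) → ¬b b) , (λ (_ , ¬a) → ¬a a)
  from′ (no ¬a) (no ¬b) _ = (λ (a , _) → ¬a a) , (λ (b , _) → ¬b b)

_⇔ᶜ?_ : ∀ {A B : Set} → Dec A → Dec B → Dec (A ⇔ᶜ B)
a? ⇔ᶜ? b? = map′ (⇔ᶜ⇔does≡ a? b? .from) (⇔ᶜ⇔does≡ a? b? .to) (does a? Bool.≟ does b?)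

does-≟-not : ∀ b c → does (b Bool.≟ not c) ≡ b xor c
does-≟-not false false = refl
does-≟-not false true  = refl
does-≟-not true  false = refl
does-≟-not true  true  = refl

Sat-carryEquation : ∀ {t ρ} i → Sat t (carryEquation i) ρ ⇔
                    (facts (ρ vx) (suc i * 2) ≡ facts (ρ vx) (suc (i * 2)) ∧ facts (ρ vx) (i * 2))
Sat-carryEquation {ρ = ρ} i =
  ⇔ᶜ⇔does≡ (above? (ρ vx) (carryL (suc i))) (above? (ρ vx) (bitL i) ×-dec above? (ρ vx) (carryL i))

Sat-incrementBit : ∀ {t ρ} i → Sat t (incrementBit i) ρ ⇔
                   (facts (ρ vy) (suc (i * 2)) ≡ facts (ρ vx) (suc (i * 2)) xor facts (ρ vx) (i * 2))
Sat-incrementBit {ρ = ρ} i = mk⇔ (λ sat → trans (sat⇔ .to sat) (does-≟-not bx cx))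
                                 (λ equation → sat⇔ .from (trans equation (sym (does-≟-not bx cx))))
  where
  bx = facts (ρ vx) (suc (i * 2))
  cx = facts (ρ vx) (i * 2)
  sat⇔ = ⇔ᶜ⇔does≡ (above? (ρ vy) (bitL i)) (above? (ρ vx) (bitL i) ⇔ᶜ? ¬? (above? (ρ vx) (carryL i)))

Sat-⋀ : ∀ {t ρ} n (φ : Fin n → Form) → Sat t (⋀ n φ) ρ ⇔ (∀ i → Sat t (φ i) ρ)
Sat-⋀ {t} {ρ} n φ = mk⇔ (to′ n φ) (from′ n φ)
  where
  to′ : ∀ n (φ : Fin n → Form) → Sat t (⋀ n φ) ρ → ∀ i → Sat t (φ i) ρ
  to′ (suc n) φ (φ₀ , _)  fzero    = φ₀
  to′ (suc n) φ (_ , φ₊) (fsuc i) = to′ n (φ ∘ fsuc) φ₊ i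
  from′ : ∀ n (φ : Fin n → Form) → (∀ i → Sat t (φ i) ρ) → Sat t (⋀ n φ) ρ
  from′ zero    φ _  = ρ vx , refl
  from′ (suc n) φ φᵢ = φᵢ fzero , from′ n (φ ∘ fsuc) (φᵢ ∘ fsuc)

-- counterFacts c v k: does label 2 + k sit above a counter storing v, given the carry c into its
-- lowest bit? Even k = 2i asks for the carry into bit i, odd k = 2i + 1 for bit i.
counterFacts : ∀ {n} → Bool → Vec Bool n → ℕ → Bool
counterFacts c v       zero          = c
counterFacts c []      (suc _)       = false
counterFacts c (b ∷ v) (suc zero)    = b
counterFacts c (b ∷ v) (suc (suc k)) = counterFacts (b ∧ c) v k

carryOut : ∀ {n} → Vec Bool n → Bool
carryOut {n} v = counterFacts true v (n * 2)

incWith : ∀ {n} → Bool → Vec Bool n → Vec Bool n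
incWith c []      = []
incWith c (b ∷ v) = (b xor c) ∷ incWith (b ∧ c) v

inc : ∀ {n} → Vec Bool n → Vec Bool n
inc = incWith true

CarryRule : ℕ → (ℕ → Bool) → Set
CarryRule n f = ∀ (i : Fin n) → f (suc (toℕ i) * 2) ≡ f (suc (toℕ i * 2)) ∧ f (toℕ i * 2)

bitsOf : ∀ n → (ℕ → Bool) → Vec Bool n
bitsOf n f = tabulate λ i → f (suc (toℕ i * 2))

counterFacts-bit : ∀ {n} c (v : Vec Bool n) i → counterFacts c v (suc (toℕ i * 2)) ≡ Vec.lookup v i
counterFacts-bit c (b ∷ v) fzero    = refl
counterFacts-bit c (b ∷ v) (fsuc i) = counterFacts-bit (b ∧ c) v i

counterFacts-carryRule : ∀ {n} c (v : Vec Bool n) → CarryRule n (counterFacts c v)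
counterFacts-carryRule c (b ∷ v) fzero    = refl
counterFacts-carryRule c (b ∷ v) (fsuc i) = counterFacts-carryRule (b ∧ c) v i

counterFacts-beyond : ∀ {n} c (v : Vec Bool n) k → n * 2 < k → counterFacts c v k ≡ false
counterFacts-beyond c []      (suc k)       _                 = refl
counterFacts-beyond c (b ∷ v) (suc (suc k)) (s≤s (s≤s n*2<k)) = counterFacts-beyond (b ∧ c) v k n*2<k

counterFacts-noCarry : ∀ {n} (v : Vec Bool n) j → counterFacts false v (j * 2) ≡ false
counterFacts-noCarry v       zero    = refl
counterFacts-noCarry []      (suc j) = refl
counterFacts-noCarry (b ∷ v) (suc j) rewrite Bool.∧-zeroʳ b = counterFacts-noCarry v j

lookup-incWith : ∀ {n} c (v : Vec Bool n) i → Vec.lookup (incWith c v) i ≡ Vec.lookup v i xor counterFacts c v (toℕ i * 2)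
lookup-incWith c (b ∷ v) fzero    = refl
lookup-incWith c (b ∷ v) (fsuc i) = lookup-incWith (b ∧ c) v i

incWith-false : ∀ {n} (v : Vec Bool n) → incWith false v ≡ v
incWith-false []      = refl
incWith-false (b ∷ v) rewrite Bool.∧-zeroʳ b = cong₂ _∷_ (Bool.xor-identityʳ b) (incWith-false v)

CarryRule⇒counterFacts : ∀ n f → CarryRule n f → ∀ j → j ≤ n → f (j * 2) ≡ counterFacts (f 0) (bitsOf n f) (j * 2)
CarryRule⇒counterFacts n       f rule zero    _         = refl
CarryRule⇒counterFacts (suc n) f rule (suc j) (s≤s j≤n) rewrite sym (rule fzero) =
  CarryRule⇒counterFacts n (λ k → f (2 + k)) (rule ∘ fsuc) j j≤n

inc-induction : ∀ {n} (P : Vec Bool n → Set) → P (replicate n false) →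
                (∀ v → carryOut v ≡ false → P v → P (inc v)) → ∀ v → P v
inc-induction {zero}  P P₀ P-inc [] = P₀
inc-induction {suc n} P P₀ P-inc = λ { (false ∷ v) → P-even v ; (true ∷ v) → even⇒odd v (P-even v) }
  where
  even⇒odd : ∀ v → P (false ∷ v) → P (true ∷ v)
  even⇒odd v = subst (λ u → P (true ∷ u)) (incWith-false v) ∘ P-inc (false ∷ v) (counterFacts-noCarry v n)
  P-even : ∀ v → P (false ∷ v)
  P-even = inc-induction (P ∘ (false ∷_)) P₀ λ v no-overflow → P-inc (true ∷ v) no-overflow ∘ even⇒odd v

tailsWith : ∀ {n} → Bool → List (Vec Bool (suc n)) → List (Vec Bool n)
tailsWith b []            = []
tailsWith b ((c ∷ v) ∷ L) with b Bool.≟ c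
... | yes _ = v ∷ tailsWith b L
... | no  _ = tailsWith b L

∈-tailsWith : ∀ {n} b {v : Vec Bool n} L → (b ∷ v) ∈ L → v ∈ tailsWith b L
∈-tailsWith b ((c ∷ w) ∷ L) (here refl) with b Bool.≟ b
... | yes _  = here refl
... | no b≢b = contradiction refl b≢b
∈-tailsWith b ((c ∷ w) ∷ L) (there v∈L) with b Bool.≟ c
... | yes _ = there (∈-tailsWith b L v∈L)
... | no  _ = ∈-tailsWith b L v∈L

length-tailsWith : ∀ {n} (L : List (Vec Bool (suc n))) → length (tailsWith false L) + length (tailsWith true L) ≡ length L
length-tailsWith []                = refl
length-tailsWith ((false ∷ v) ∷ L) = cong suc (length-tailsWith L)
length-tailsWith ((true ∷ v) ∷ L)  = trans (+-suc _ _) (cong suc (length-tailsWith L))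

2^n≤length : ∀ n (L : List (Vec Bool n)) → (∀ v → v ∈ L) → 2 ^ n ≤ length L
2^n≤length zero    []      all∈ with () ← all∈ []
2^n≤length zero    (_ ∷ _) _    = s≤s z≤n
2^n≤length (suc n) L all∈ = begin
  2 ^ suc n                                               ≡⟨ cong (2 ^ n +_) (+-identityʳ (2 ^ n)) ⟩
  2 ^ n + 2 ^ n                                           ≤⟨ +-mono-≤ (half false) (half true) ⟩
  length (tailsWith false L) + length (tailsWith true L)  ≡⟨ length-tailsWith L ⟩
  length L                                                ∎
  where
  open ≤-Reasoning
  half : ∀ b → 2 ^ n ≤ length (tailsWith b L)
  half b = 2^n≤length n (tailsWith b L) λ v → ∈-tailsWith b L (all∈ (b ∷ v))

allVecs : ∀ n → List (Vec Bool n)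
allVecs zero    = [] ∷ []
allVecs (suc n) = List.map (false ∷_) (allVecs n) ++ List.map (true ∷_) (allVecs n)

∈-allVecs : ∀ {n} (v : Vec Bool n) → v ∈ allVecs n
∈-allVecs []          = here refl
∈-allVecs (false ∷ v) = ∈-++⁺ˡ (∈-map⁺ (false ∷_) (∈-allVecs v))
∈-allVecs (true ∷ v)  = ∈-++⁺ʳ _ (∈-map⁺ (true ∷_) (∈-allVecs v))

length-allVecs : ∀ n → length (allVecs n) ≡ 2 ^ n
length-allVecs zero    = refl
length-allVecs (suc n) = begin
  length (List.map (false ∷_) (allVecs n) ++ List.map (true ∷_) (allVecs n))
    ≡⟨ length-++ (List.map (false ∷_) (allVecs n)) ⟩
  length (List.map (false ∷_) (allVecs n)) + length (List.map (true ∷_) (allVecs n))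
    ≡⟨ cong₂ _+_ (length-map (false ∷_) (allVecs n)) (length-map (true ∷_) (allVecs n)) ⟩
  length (allVecs n) + length (allVecs n)
    ≡⟨ cong₂ _+_ (length-allVecs n) (trans (length-allVecs n) (sym (+-identityʳ (2 ^ n)))) ⟩
  2 ^ suc n ∎
  where open ≡-Reasoning

n<2^n : ∀ n → n < 2 ^ n
n<2^n zero    = s≤s z≤n
n<2^n (suc n) = begin-strict
  suc n          ≡⟨ +-comm 1 n ⟩
  n + 1          <⟨ +-mono-<-≤ (n<2^n n) (m^n>0 2 n) ⟩
  2 ^ n + 2 ^ n  ≡⟨ cong (2 ^ n +_) (sym (+-identityʳ (2 ^ n))) ⟩
  2 ^ suc n      ∎
  where open ≤-Reasoning

-- The model

singleton : ℕ → ℕ → Bool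
singleton L j = j ≡ᵇ L

singleton-true : ∀ L j → singleton L j ≡ true ⇔ j ≡ L
singleton-true L j = mk⇔ (≡ᵇ⇒≡ j L ∘ T-≡ .from) (T-≡ .to ∘ ≡⇒≡ᵇ j L)

chain : List ℕ → Tree
chain []       = node (singleton counterL) []
chain (k ∷ ks) = node (singleton (2 + k)) (chain ks ∷ [])

chain-leaf : ∀ ks → Σ (Pos (chain ks)) Counter
chain-leaf []       = root , refl
chain-leaf (k ∷ ks) = let p , counter = chain-leaf ks in child fzero p , counter

chain-counter-unique : ∀ ks (p q : Pos (chain ks)) → Counter p → Counter q → p ≡ q
chain-counter-unique []       root            root            _  _  = refl
chain-counter-unique (k ∷ ks) (child fzero p) (child fzero q) cp cq = cong (child fzero) (chain-counter-unique ks p q cp cq)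

chain-not-spine : ∀ ks (p : Pos (chain ks)) → ¬ Spine p
chain-not-spine []       root ()
chain-not-spine (k ∷ ks) root ()
chain-not-spine (k ∷ ks) (child fzero p) = chain-not-spine ks p

chain-above : ∀ ks (p : Pos (chain ks)) → Counter p → ∀ k → Above p (2 + k) ⇔ k ∈ ks
chain-above []        root            _       k = mk⇔ (λ { (_ , () , _) }) λ ()
chain-above (k′ ∷ ks) (child fzero p) counter k = mk⇔
  (λ above → case Above-child .to above of λ
     { (inj₁ lab)    → here (suc-injective (suc-injective (singleton-true _ _ .to lab)))
     ; (inj₂ above′) → there (chain-above ks p counter k .to above′) })
  (λ { (here refl)   → Above-child .from (inj₁ (singleton-true (2 + k′) _ .from refl))
     ; (there k∈ks)  → Above-child .from (inj₂ (chain-above ks p counter k .from k∈ks)) })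

gadget : ∀ {n} → Vec Bool n → List ℕ
gadget {n} v = List.filterᵇ (counterFacts true v) (List.upTo (suc (n * 2)))

∈-gadget : ∀ {n} (v : Vec Bool n) k → k ∈ gadget v ⇔ T (counterFacts true v k)
∈-gadget {n} v k = mk⇔ (proj₂ ∘ ∈-filter⁻ (T? ∘ counterFacts true v) {xs = List.upTo (suc (n * 2))})
  (λ fact → ∈-filter⁺ (T? ∘ counterFacts true v) (∈-upTo⁺ (s≤s (in-range fact))) fact)
  where
  in-range : T (counterFacts true v k) → k ≤ n * 2
  in-range fact with k ≤? n * 2
  ... | yes k≤n*2 = k≤n*2
  ... | no  k≰n*2 = contradiction (subst T (counterFacts-beyond true v k (≰⇒> k≰n*2)) fact) λ ()

Displays : ∀ {n t} → Pos t → Vec Bool n → Set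
Displays p v = ∀ k → Above p (2 + k) ⇔ T (counterFacts true v k)

Displays⇒facts : ∀ {n t} {p : Pos t} {v : Vec Bool n} → Displays p v → ∀ k → facts p k ≡ counterFacts true v k
Displays⇒facts {p = p} {v} displays k = does-⇔ (displays k) (above? p (2 + k)) (T? (counterFacts true v k))

chain-displays : ∀ {n} (v : Vec Bool n) (p : Pos (chain (gadget v))) → Counter p → Displays p v
chain-displays v p counter k = ⇔-trans (chain-above (gadget v) p counter k) (∈-gadget v k)

spineOf : ∀ {n} → List (Vec Bool n) → Tree
spineOf []       = node (singleton spineL) []
spineOf (v ∷ vs) = node (singleton spineL) (chain (gadget v) ∷ spineOf vs ∷ [])

Displays-below-spine : ∀ {n ts i} {p : Pos (lookup ts i)} {v : Vec Bool n} → Displays p v →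
                       Displays {t = node (singleton spineL) ts} (child i p) v
Displays-below-spine displays k = ⇔-trans (Above-child-unlabelled refl) (displays k)

spineOf-counter : ∀ {n} (vs : List (Vec Bool n)) (p : Pos (spineOf vs)) → Counter p →
                  Σ (Vec Bool n) λ v → v ∈ vs × Displays p v
spineOf-counter []       root ()
spineOf-counter (v ∷ vs) root ()
spineOf-counter (v ∷ vs) (child fzero p) counter = v , here refl , Displays-below-spine (chain-displays v p counter)
spineOf-counter (v ∷ vs) (child (fsuc fzero) p) counter =
  let w , w∈vs , displays = spineOf-counter vs p counter in w , there w∈vs , Displays-below-spine displays

spineOf-displays : ∀ {n} (vs : List (Vec Bool n)) {v} → v ∈ vs → Σ (Pos (spineOf vs)) λ p → Counter p × Displays p v
spineOf-displays (v ∷ vs) (here refl) =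
  let p , counter = chain-leaf (gadget v) in child fzero p , counter , Displays-below-spine (chain-displays v p counter)
spineOf-displays (w ∷ vs) (there v∈vs) =
  let p , counter , displays = spineOf-displays vs v∈vs in child (fsuc fzero) p , counter , Displays-below-spine displays

spineOf-comparable : ∀ {n} (vs : List (Vec Bool n)) (p q : Pos (spineOf vs)) → Spine p → Spine q →
                     p ≡ q ⊎ AncOf p q ⊎ AncOf q p
spineOf-comparable []       root root _ _ = inj₁ refl
spineOf-comparable (v ∷ vs) root root _ _ = inj₁ refl
spineOf-comparable (v ∷ vs) root (child i q) _ _ = inj₂ (inj₁ (root-anc i q))
spineOf-comparable (v ∷ vs) (child i p) root _ _ = inj₂ (inj₂ (root-anc i p))
spineOf-comparable (v ∷ vs) (child fzero p) q spine _ = contradiction spine (chain-not-spine (gadget v) p)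
spineOf-comparable (v ∷ vs) (child (fsuc fzero) p) (child fzero q) _ spine = contradiction spine (chain-not-spine (gadget v) q)
spineOf-comparable (v ∷ vs) (child (fsuc fzero) p) (child (fsuc fzero) q) sp sq with spineOf-comparable vs p q sp sq
... | inj₁ refl       = inj₁ refl
... | inj₂ (inj₁ p<q) = inj₂ (inj₁ (step (fsuc fzero) p<q))
... | inj₂ (inj₂ q<p) = inj₂ (inj₂ (step (fsuc fzero) q<p))

⊴-child⁻ : ∀ {l ts i} {p : Pos (lookup ts i)} {y : Pos (node l ts)} → child i p ⊴ y →
           Σ (Pos (lookup ts i)) λ y′ → y ≡ child i y′ × p ⊴ y′
⊴-child⁻ {p = p} (inj₁ refl)                   = p , refl , inj₁ refl
⊴-child⁻         (inj₂ (step _ {q = y′} p<y′)) = y′ , refl , inj₂ p<y′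

spineOf-uniform : ∀ {n} (vs : List (Vec Bool n)) (p y₁ y₂ : Pos (spineOf vs)) → ¬ Spine p →
                  p ⊴ y₁ → p ⊴ y₂ → Counter y₁ → Counter y₂ → y₁ ≡ y₂
spineOf-uniform []       root _ _ ¬spine = contradiction refl ¬spine
spineOf-uniform (v ∷ vs) root _ _ ¬spine = contradiction refl ¬spine
spineOf-uniform (v ∷ vs) (child fzero p) y₁ y₂ _ p⊴y₁ p⊴y₂ c₁ c₂
  with y₁′ , refl , _ ← ⊴-child⁻ p⊴y₁ | y₂′ , refl , _ ← ⊴-child⁻ p⊴y₂ =
  cong (child fzero) (chain-counter-unique (gadget v) y₁′ y₂′ c₁ c₂)
spineOf-uniform (v ∷ vs) (child (fsuc fzero) p) y₁ y₂ ¬spine p⊴y₁ p⊴y₂ c₁ c₂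
  with y₁′ , refl , p⊴y₁′ ← ⊴-child⁻ p⊴y₁ | y₂′ , refl , p⊴y₂′ ← ⊴-child⁻ p⊴y₂ =
  cong (child (fsuc fzero)) (spineOf-uniform vs p y₁′ y₂′ ¬spine p⊴y₁′ p⊴y₂′ c₁ c₂)

counterModel : ℕ → Tree
counterModel n = spineOf (allVecs n)

-- Sat of ∀F and ⇒F is a negated Σ, so each conjunct is proved by refuting a counterexample.
counterModel-sat : ∀ n ρ → Sat (counterModel n) (counterφ n) ρ
counterModel-sat n ρ =
  spine-chain , carry-first , zero-counter , successor , Sat-⋀ n _ .from carry-rule , Sat-⋀ n _ .from bits-uniform
  where
  open ≡-Reasoning
  vs = allVecs n

  counter-facts : ∀ p → Counter p → Σ (Vec Bool n) λ v → ∀ k → facts p k ≡ counterFacts true v k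
  counter-facts p counter = let v , _ , displays = spineOf-counter vs p counter in v , Displays⇒facts displays

  spine-chain : Sat (counterModel n) spineIsChain ρ
  spine-chain (p , ¬∀) = ¬∀ λ (q , ¬imp) → ¬imp λ ((sp , sq) , ¬comparable) →
    ¬comparable (spineOf-comparable vs p q sp sq)

  carry-first : Sat (counterModel n) carryIntoFirst ρ
  carry-first (p , ¬imp) = ¬imp λ (counter , ¬above) →
    let _ , _ , displays = spineOf-counter vs p counter in ¬above (displays 0 .from _)

  zero-counter : Sat (counterModel n) (zeroCounter n) ρ
  zero-counter = let p , counter , displays = spineOf-displays vs (∈-allVecs (replicate n false)) in
    p , counter , Sat-⋀ n _ .from λ i above →
      subst T (trans (counterFacts-bit true (replicate n false) i) (lookup-replicate i false)) (displays (suc (toℕ i * 2)) .to above)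

  successor : Sat (counterModel n) (successorCounter n) ρ
  successor (p , ¬imp) = ¬imp λ ((counter , _) , ¬successor) →
    let v , p-facts = counter-facts p counter
        q , counter′ , displays = spineOf-displays vs (∈-allVecs (inc v))
    in ¬successor (q , counter′ , Sat-⋀ n _ .from λ i →
      Sat-incrementBit {ρ = update (update ρ vx p) vy q} (toℕ i) .from (begin
        facts q (suc (toℕ i * 2))                           ≡⟨ Displays⇒facts displays _ ⟩
        counterFacts true (inc v) (suc (toℕ i * 2))         ≡⟨ counterFacts-bit true (inc v) i ⟩
        Vec.lookup (inc v) i                                ≡⟨ lookup-incWith true v i ⟩
        Vec.lookup v i xor counterFacts true v (toℕ i * 2)  ≡⟨ cong₂ _xor_ (sym (trans (p-facts _) (counterFacts-bit true v i)))
                                                                           (sym (p-facts _)) ⟩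
        facts p (suc (toℕ i * 2)) xor facts p (toℕ i * 2)   ∎))

  carry-rule : ∀ i → Sat (counterModel n) (carryRule (toℕ i)) ρ
  carry-rule i (p , ¬imp) = ¬imp λ (counter , ¬equation) → let v , p-facts = counter-facts p counter in
    ¬equation (Sat-carryEquation {ρ = update ρ vx p} (toℕ i) .from (begin
      facts p (suc (toℕ i) * 2)                                                ≡⟨ p-facts _ ⟩
      counterFacts true v (suc (toℕ i) * 2)                                    ≡⟨ counterFacts-carryRule true v i ⟩
      counterFacts true v (suc (toℕ i * 2)) ∧ counterFacts true v (toℕ i * 2)
        ≡⟨ sym (cong₂ _∧_ (p-facts _) (p-facts _)) ⟩
      facts p (suc (toℕ i * 2)) ∧ facts p (toℕ i * 2)                          ∎))

  bits-uniform : ∀ i → Sat (counterModel n) (bitsUniform (toℕ i)) ρ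
  bits-uniform i (p , ¬imp) = ¬imp λ (¬spine , ¬¬split) →
    ¬¬split λ ((y₁ , p⊴y₁ , c₁ , bit₁) , (y₂ , p⊴y₂ , c₂ , ¬bit₂)) →
    ¬bit₂ (subst (λ y → Above y (bitL (toℕ i))) (spineOf-uniform vs p y₁ y₂ ¬spine p⊴y₁ p⊴y₂ c₁ c₂) bit₁)

chain-binary : ∀ ks → Binary (chain ks)
chain-binary []       = bin z≤n λ ()
chain-binary (k ∷ ks) = bin (s≤s z≤n) λ { fzero → chain-binary ks }

spineOf-binary : ∀ {n} (vs : List (Vec Bool n)) → Binary (spineOf vs)
spineOf-binary []       = bin z≤n λ ()
spineOf-binary (v ∷ vs) = bin (s≤s (s≤s z≤n)) λ { fzero → chain-binary (gadget v) ; (fsuc fzero) → spineOf-binary vs }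

SingletonLabels : Tree → Set
SingletonLabels t = ∀ (p : Pos t) → Σ ℕ λ L → labelAt p ≡ singleton L

SingletonLabels⇒UAR : ∀ {t} → SingletonLabels t → UAR t
SingletonLabels⇒UAR singletons p with L , lab ← singletons p rewrite lab =
  L , singleton-true L L .from refl , λ j lab-j → singleton-true L j .to lab-j

chain-singletons : ∀ ks → SingletonLabels (chain ks)
chain-singletons []       root            = counterL , refl
chain-singletons (k ∷ ks) root            = 2 + k , refl
chain-singletons (k ∷ ks) (child fzero p) = chain-singletons ks p

spineOf-singletons : ∀ {n} (vs : List (Vec Bool n)) → SingletonLabels (spineOf vs)
spineOf-singletons []       root                   = spineL , refl
spineOf-singletons (v ∷ vs) root                   = spineL , refl
spineOf-singletons (v ∷ vs) (child fzero p)        = chain-singletons (gadget v) p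
spineOf-singletons (v ∷ vs) (child (fsuc fzero) p) = spineOf-singletons vs p

counterModel-BinUAR : ∀ n → BinUAR (counterModel n)
counterModel-BinUAR n = spineOf-binary (allVecs n) , SingletonLabels⇒UAR (spineOf-singletons (allVecs n))

depth-chain : ∀ ks → depth (chain ks) ≡ length ks
depth-chain []       = refl
depth-chain (k ∷ ks) = cong suc (trans (⊔-identityʳ _) (depth-chain ks))

depth-spineOf : ∀ {n} (vs : List (Vec Bool n)) → depth (spineOf vs) ≤ length vs + suc (n * 2)
depth-spineOf []           = z≤n
depth-spineOf {n} (v ∷ vs) rewrite ⊔-identityʳ (depth (spineOf vs)) | depth-chain (gadget v) =
  s≤s (⊔-lub (≤-trans length-gadget (m≤n+m _ (length vs))) (depth-spineOf vs))
  where
  length-gadget : length (gadget v) ≤ suc (n * 2)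
  length-gadget = ≤-trans (length-filter (T? ∘ counterFacts true v) (List.upTo (suc (n * 2)))) (≤-reflexive (length-upTo _))

depth-counterModel : ∀ n → depth (counterModel n) ≤ 3 * 2 ^ n
depth-counterModel n = begin
  depth (counterModel n)            ≤⟨ depth-spineOf (allVecs n) ⟩
  length (allVecs n) + suc (n * 2)  ≡⟨ cong (_+ suc (n * 2)) (length-allVecs n) ⟩
  2 ^ n + suc (n * 2)               ≤⟨ +-monoʳ-≤ (2 ^ n) (*-monoˡ-< 2 (n<2^n n)) ⟩
  2 ^ n + 2 ^ n * 2                 ≡⟨ cong (2 ^ n +_) (*-comm (2 ^ n) 2) ⟩
  3 * 2 ^ n                         ∎
  where open ≤-Reasoning

-- The lower bound on the depth

maxDepth-lookup : ∀ ts i → depth (lookup ts i) ≤ maxDepth ts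
maxDepth-lookup (u ∷ ts) fzero    = m≤m⊔n (depth u) (maxDepth ts)
maxDepth-lookup (u ∷ ts) (fsuc i) = ≤-trans (maxDepth-lookup ts i) (m≤n⊔m (depth u) (maxDepth ts))

depth-child : ∀ {l ts} i → depth (lookup ts i) < depth (node l ts)
depth-child {ts = u ∷ ts} i = s≤s (maxDepth-lookup (u ∷ ts) i)

cover-bound : ∀ {x y d D} → d < D → x ≤ 2 * suc d → y ≤ 1 → suc (x + y) ≤ 2 * suc D
cover-bound {x} {y} {d} {D} d<D x≤ y≤1 = s≤s (begin
  x + y          ≤⟨ +-mono-≤ (≤-trans x≤ (*-monoʳ-≤ 2 d<D)) y≤1 ⟩
  2 * D + 1      ≡⟨ solve (D List.∷ List.[]) ⟩
  D + 1 * suc D  ∎)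
  where open ≤-Reasoning

-- The conclusion is a decidable inequality, so the argument may run in the double-negation
-- monad; this is what lets non-spine-cover avoid searching a subtree for a counter.
module LowerBound {t : Tree} {n : ℕ} {ρ : Assign t}
  (spine-chain : Sat t spineIsChain ρ) (carry-first : Sat t carryIntoFirst ρ)
  (zero-counter : Sat t (zeroCounter n) ρ) (successor : Sat t (successorCounter n) ρ)
  (carry-rules : Sat t (⋀ n (carryRule ∘ toℕ)) ρ) (bits-uniform : Sat t (⋀ n (bitsUniform ∘ toℕ)) ρ) where

  open RawMonad (¬¬-Monad {a = 0ℓ})

  bits : Pos t → Vec Bool n
  bits p = bitsOf n (facts p)

  counter-carryRule : ∀ x → Counter x → CarryRule n (facts x)
  counter-carryRule x counter i = decidable-stable (_ Bool.≟ _) λ ¬equation →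
    Sat-⋀ n _ .to carry-rules i (x , λ ¬imp →
      ¬imp (counter , ¬equation ∘ Sat-carryEquation {ρ = update ρ vx x} (toℕ i) .to))

  counter-carry₀ : ∀ x → Counter x → facts x 0 ≡ true
  counter-carry₀ x counter = dec-true (above? x 2) (decidable-stable (above? x 2) λ ¬above →
    carry-first (x , λ ¬imp → ¬imp (counter , ¬above)))

  counter-carries : ∀ x → Counter x → ∀ j → j ≤ n → facts x (j * 2) ≡ counterFacts true (bits x) (j * 2)
  counter-carries x counter j j≤n =
    trans (CarryRule⇒counterFacts n (facts x) (counter-carryRule x counter) j j≤n)
          (cong (λ c → counterFacts c (bits x) (j * 2)) (counter-carry₀ x counter))

  successor-bits : ∀ x y → Counter x → (∀ i → Sat t (incrementBit (toℕ i)) (update (update ρ vx x) vy y)) →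
                   bits y ≡ inc (bits x)
  successor-bits x y counter increments = trans (tabulate-cong bit-i) (tabulate∘lookup (inc (bits x)))
    where
    open ≡-Reasoning
    bit-i : ∀ i → facts y (suc (toℕ i * 2)) ≡ Vec.lookup (inc (bits x)) i
    bit-i i = begin
      facts y (suc (toℕ i * 2))
        ≡⟨ Sat-incrementBit {ρ = update (update ρ vx x) vy y} (toℕ i) .to (increments i) ⟩
      facts x (suc (toℕ i * 2)) xor facts x (toℕ i * 2)
        ≡⟨ cong₂ _xor_ (sym (lookup∘tabulate _ i)) (counter-carries x counter (toℕ i) (<⇒≤ (toℕ<n i))) ⟩
      Vec.lookup (bits x) i xor counterFacts true (bits x) (toℕ i * 2)
        ≡⟨ sym (lookup-incWith true (bits x) i) ⟩
      Vec.lookup (inc (bits x)) i ∎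

  Realized : Vec Bool n → Set
  Realized v = ¬ ¬ Σ (Pos t) λ x → Counter x × bits x ≡ v

  realized-zero : Realized (replicate n false)
  realized-zero ¬realized = let x , counter , no-bits = zero-counter in
    ¬realized (x , counter , trans
      (tabulate-cong λ i → trans (dec-false (above? x _) (Sat-⋀ n _ .to no-bits i)) (sym (lookup-replicate i false)))
      (tabulate∘lookup (replicate n false)))

  realized-inc : ∀ v → carryOut v ≡ false → Realized v → Realized (inc v)
  realized-inc v no-overflow realized ¬realized = realized λ (x , counter , bits≡v) →
    successor (x , λ ¬imp → ¬imp ((counter , no-carry x counter bits≡v) , λ (y , counter′ , increments) →
      ¬realized (y , counter′ , trans (successor-bits x y counter (Sat-⋀ n _ .to increments)) (cong inc bits≡v))))
    where
    open ≡-Reasoning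
    no-carry : ∀ x → Counter x → bits x ≡ v → ¬ Above x (carryL n)
    no-carry x counter bits≡v above = contradiction (begin
      true               ≡⟨ sym (dec-true (above? x _) above) ⟩
      facts x (n * 2)    ≡⟨ counter-carries x counter n ≤-refl ⟩
      carryOut (bits x)  ≡⟨ cong carryOut bits≡v ⟩
      carryOut v         ≡⟨ no-overflow ⟩
      false              ∎) λ ()

  all-realized : ∀ v → Realized v
  all-realized = inc-induction Realized realized-zero realized-inc

  counters-agree : ∀ p y₁ y₂ → ¬ Spine p → p ⊴ y₁ → p ⊴ y₂ → Counter y₁ → Counter y₂ → bits y₁ ≡ bits y₂
  counters-agree p y₁ y₂ ¬spine p⊴y₁ p⊴y₂ c₁ c₂ = tabulate-cong bit-i
    where
    disagreement : ∀ i {z₁ z₂} → p ⊴ z₁ → p ⊴ z₂ → Counter z₁ → Counter z₂ →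
                   Above z₁ (bitL (toℕ i)) → ¬ Above z₂ (bitL (toℕ i)) → ⊥
    disagreement i p⊴z₁ p⊴z₂ d₁ d₂ a₁ ¬a₂ = Sat-⋀ n _ .to bits-uniform i
      (p , λ ¬imp → ¬imp (¬spine , λ ¬split → ¬split ((_ , p⊴z₁ , d₁ , a₁) , (_ , p⊴z₂ , d₂ , ¬a₂))))
    bit-i : ∀ i → facts y₁ (suc (toℕ i * 2)) ≡ facts y₂ (suc (toℕ i * 2))
    bit-i i with above? y₁ (bitL (toℕ i)) | above? y₂ (bitL (toℕ i))
    ... | yes _  | yes _  = refl
    ... | no  _  | no  _  = refl
    ... | yes a₁ | no ¬a₂ = ⊥-elim (disagreement i p⊴y₁ p⊴y₂ c₁ c₂ a₁ ¬a₂)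
    ... | no ¬a₁ | yes a₂ = ⊥-elim (disagreement i p⊴y₂ p⊴y₁ c₂ c₁ a₂ ¬a₁)

  record Embedding (u : Tree) : Set where
    field
      pos       : Pos u → Pos t
      anc⁺      : ∀ {a b} → AncOf a b → AncOf (pos a) (pos b)
      anc⁻      : ∀ {a b} → AncOf (pos a) (pos b) → AncOf a b
      injective : ∀ {a b} → pos a ≡ pos b → a ≡ b
  open Embedding

  id-embedding : Embedding t
  id-embedding = record { pos = λ p → p ; anc⁺ = λ a<b → a<b ; anc⁻ = λ a<b → a<b ; injective = λ a≡b → a≡b }

  child-embedding : ∀ {l ts} → Embedding (node l ts) → ∀ i → Embedding (lookup ts i)
  child-embedding E i = record
    { pos       = pos E ∘ child i
    ; anc⁺      = anc⁺ E ∘ step i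
    ; anc⁻      = λ a<b → case anc⁻ E a<b of λ { (step _ a<b′) → a<b′ }
    ; injective = λ a≡b → case injective E a≡b of λ { refl → refl }
    }

  pos-⊴ : ∀ {u} (E : Embedding u) {a b} → a ⊴ b → pos E a ⊴ pos E b
  pos-⊴ E (inj₁ refl) = inj₁ refl
  pos-⊴ E (inj₂ a<b)  = inj₂ (anc⁺ E a<b)

  root-⊴ : ∀ {u} (q : Pos u) → rootPos u ⊴ q
  root-⊴ root        = inj₁ refl
  root-⊴ (child i q) = inj₂ (root-anc i q)

  siblings-not-both-spine : ∀ {l a b} (E : Embedding (node l (a ∷ b ∷ []))) (p : Pos a) (q : Pos b) →
                            Spine (pos E (child fzero p)) → Spine (pos E (child (fsuc fzero) q)) → ⊥
  siblings-not-both-spine E p q sp sq =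
    spine-chain (pos E (child fzero p) , λ ¬∀ → ¬∀ (pos E (child (fsuc fzero) q) , λ ¬imp → ¬imp ((sp , sq) , λ { (inj₁ p≡q)        → case injective E p≡q of λ ()
                        ; (inj₂ (inj₁ p<q)) → case anc⁻ E p<q of λ ()
                        ; (inj₂ (inj₂ q<p)) → case anc⁻ E q<p of λ () })))

  -- A spine root contributes its own value too, so the count does not rely on the unary alphabet restriction.
  Cover : ∀ {u} → Embedding u → Set
  Cover {u} E = Σ (List (Vec Bool n)) λ L →
      (∀ q → Counter (pos E q) → bits (pos E q) ∈ L)
    × length L ≤ 2 * suc (depth u)
    × (¬ Spine (pos E (rootPos u)) → length L ≤ 1)

  non-spine-cover : ∀ {u} (E : Embedding u) → ¬ Spine (pos E (rootPos u)) → ¬ ¬ Cover E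
  non-spine-cover {u} E ¬spine = ¬¬-map cover′ ¬¬-excluded-middle
    where
    cover′ : Dec (Σ (Pos u) λ q → Counter (pos E q)) → Cover E
    cover′ (yes (q₀ , c₀)) = bits (pos E q₀) ∷ [] ,
      (λ q c → here (counters-agree (pos E (rootPos u)) _ _ ¬spine (pos-⊴ E (root-⊴ q)) (pos-⊴ E (root-⊴ q₀)) c c₀)) ,
      s≤s z≤n , λ _ → ≤-refl
    cover′ (no no-counter) = [] , (λ q c → contradiction (q , c) no-counter) , z≤n , λ _ → z≤n

  leaf-cover : ∀ {l} (E : Embedding (node l [])) → Spine (pos E root) → Cover E
  leaf-cover E spine =
    bits (pos E root) ∷ [] , (λ { root _ → here refl }) , s≤s z≤n , λ ¬spine → contradiction spine ¬spine

  unary-cover : ∀ {l a} (E : Embedding (node l (a ∷ []))) → Spine (pos E root) → Cover (child-embedding E fzero) → Cover E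
  unary-cover {l} {a} E spine (La , coversA , lengthA , _) =
    bits (pos E root) ∷ La ,
    (λ { root _ → here refl ; (child fzero q) c → there (coversA q c) }) ,
    ≤-trans (s≤s (m≤m+n _ 0)) (cover-bound (depth-child {l} {a ∷ []} fzero) lengthA z≤n) ,
    λ ¬spine → contradiction spine ¬spine

  binary-cover : ∀ {l a b} (E : Embedding (node l (a ∷ b ∷ []))) → Spine (pos E root) →
                 Cover (child-embedding E fzero) → Cover (child-embedding E (fsuc fzero)) → Cover E
  binary-cover {l} {a} {b} E spine (La , coversA , lengthA , flatA) (Lb , coversB , lengthB , flatB) =
    bits (pos E root) ∷ (La ++ Lb) ,
    (λ { root _ → here refl
       ; (child fzero q) c        → there (∈-++⁺ˡ (coversA q c))
       ; (child (fsuc fzero) q) c → there (∈-++⁺ʳ La (coversB q c)) }) ,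
    subst (λ k → suc k ≤ 2 * suc D) (sym (length-++ La)) bound ,
    λ ¬spine → contradiction spine ¬spine
    where
    D = depth (node l (a ∷ b ∷ []))
    bound : suc (length La + length Lb) ≤ 2 * suc D
    bound with labelAt (pos E (child fzero (rootPos a))) spineL Bool.≟ true
    ... | no ¬spineA = subst (λ k → suc k ≤ 2 * suc D) (+-comm (length Lb) (length La))
                         (cover-bound (depth-child {l} {a ∷ b ∷ []} (fsuc fzero)) lengthB (flatA ¬spineA))
    ... | yes spineA = cover-bound (depth-child {l} {a ∷ b ∷ []} fzero) lengthA
                         (flatB (siblings-not-both-spine E (rootPos a) (rootPos b) spineA))

  cover : ∀ {u} → Binary u → (E : Embedding u) → ¬ ¬ Cover E
  spine-cover : ∀ {u} → Binary u → (E : Embedding u) → Spine (pos E (rootPos u)) → ¬ ¬ Cover E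

  cover {u} binary E with labelAt (pos E (rootPos u)) spineL Bool.≟ true
  ... | yes spine = spine-cover binary E spine
  ... | no ¬spine = non-spine-cover E ¬spine

  spine-cover {node l []} _ E spine = return (leaf-cover E spine)
  spine-cover {node l (a ∷ [])} (bin _ binary) E spine = do
    coverA ← cover (binary fzero) (child-embedding E fzero)
    return (unary-cover E spine coverA)
  spine-cover {node l (a ∷ b ∷ [])} (bin _ binary) E spine = do
    coverA ← cover (binary fzero) (child-embedding E fzero)
    coverB ← cover (binary (fsuc fzero)) (child-embedding E (fsuc fzero))
    return (binary-cover E spine coverA coverB)
  spine-cover {node l (a ∷ b ∷ c ∷ ts)} (bin (s≤s (s≤s ())) _) E spine

  2^n≤2*[1+depth] : Binary t → 2 ^ n ≤ 2 * suc (depth t)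
  2^n≤2*[1+depth] binary = decidable-stable (2 ^ n ≤? 2 * suc (depth t)) do
    L , covers , length≤ , _ ← cover binary id-embedding
    let all∈L v = decidable-stable (v ∈? L)
                    (¬¬-map (λ (x , c , bits≡v) → subst (_∈ L) bits≡v (covers x c)) (all-realized v))
    return (≤-trans (2^n≤length n L all∈L) length≤)
    where open import Data.List.Membership.DecPropositional (≡-dec Bool._≟_) using (_∈?_)

counterφ⇒2^n≤2*[1+depth] : ∀ {t n} → Binary t → Models t (counterφ n) → 2 ^ n ≤ 2 * suc (depth t)
counterφ⇒2^n≤2*[1+depth] binary (spine-chain , carry-first , zero-counter , successor , carry-rules , bits-uniform) =
  LowerBound.2^n≤2*[1+depth] spine-chain carry-first zero-counter successor carry-rules bits-uniform binary

2^n≤2*[1+d]⇒2^n≤4*d : ∀ {n d} → 2 ≤ n → 2 ^ n ≤ 2 * suc d → 2 ^ n ≤ 4 * d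
2^n≤2*[1+d]⇒2^n≤4*d {n} {zero}  2≤n 2^n≤2 =
  contradiction (≤-trans (^-monoʳ-≤ 2 2≤n) 2^n≤2) λ { (s≤s (s≤s ())) }
2^n≤2*[1+d]⇒2^n≤4*d {n} {suc d} 2≤n 2^n≤ = ≤-trans 2^n≤ (begin
  2 * suc (suc d)  ≡⟨ solve (d List.∷ List.[]) ⟩
  4 + 2 * d        ≤⟨ +-monoʳ-≤ 4 (*-monoˡ-≤ d {2} {4} (s≤s (s≤s z≤n))) ⟩
  4 + 4 * d        ≡⟨ solve (d List.∷ List.[]) ⟩
  4 * suc d        ∎)
  where open ≤-Reasoning

mainTheorem8 :
    Σ (ℕ → Form) λ φ →
      ((n : ℕ) → Sentence (φ n))
      × ((n : ℕ) → Σ Tree λ t → BinUAR t × Models t (φ n))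
      × Σ ℕ λ N → Σ ℕ λ C → Σ ℕ λ c₁ → Σ ℕ λ c₂ →
          ((n : ℕ) → N ≤ n →
              (size (φ n) ≤ C * n)
            × (Σ Tree λ t → BinUAR t × Models t (φ n) × depth t ≤ c₂ * 2 ^ n)
            × ((t : Tree) → BinUAR t → Models t (φ n) → 2 ^ n ≤ c₁ * depth t))
mainTheorem8 =
  counterφ , counterφ-sentence , (λ n → counterModel n , counterModel-BinUAR n , counterModel-sat n _) ,
  2 , 207 , 4 , 3 , λ n 2≤n →
    size-counterφ-linear (≤-trans (s≤s z≤n) 2≤n) ,
    (counterModel n , counterModel-BinUAR n , counterModel-sat n _ , depth-counterModel n) ,
    λ t (binary , _) models → 2^n≤2*[1+d]⇒2^n≤4*d 2≤n (counterφ⇒2^n≤2*[1+depth] binary models)
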